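{- Every semigroup with apartness $S$ se-embeds into the semigroup $\mathcal{T}_X^{se}$ of all strongly extensional self-maps of some set with apartness $X$; that is, there is an injective homomorphism $\varphi:S\to\mathcal{T}_X^{se}$ which is strongly extensional.
   Context: Constructive (Bishop-style) setting. A set with apartness $(X,=,\#)$: inhabited set with equality $=$ (an equivalence) and $\#$ with $\neg(x\#x)$, $x\#y\Rightarrow y\#x$, $x\#z\Rightarrow\forall y(x\#y\vee y\#z)$, extensional w.r.t. $=$. A mapping is strongly extensional (se) if $f(x)\#f(y)\Rightarrow x\#y$. A semigroup with apartness is a set with apartness with an associative operation satisfying $ax\#by\Rightarrow(a\#b\vee x\#y)$. $\mathcal{T}_X^{se}$ is the set of se-mappings $X\to X$ under composition, with $f=g\iff\forall x(f(x)=g(x))$ and $f\#g\iff\exists x(f(x)\#g(x))$; it is a semigroup with apartness. An se-embedding is a homomorphism that is injective and strongly extensional. -}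

module Defs where

open import Level using (Level; _⊔_; suc)
open import Data.Sum using (_⊎_)
open import Data.Product using (∃; _×_; _,_)
open import Relation.Nullary using (¬_)
open import Relation.Binary.Structures using (IsEquivalence)

record SetApart (c ℓ₁ ℓ₂ : Level) : Set (suc (c ⊔ ℓ₁ ⊔ ℓ₂)) where
  infix 4 _≈_ _#_
  field
    Carrier       : Set c
    _≈_           : Carrier → Carrier → Set ℓ₁
    _#_           : Carrier → Carrier → Set ℓ₂
    isEquivalence : IsEquivalence _≈_
    inhabitant    : Carrier
    #-irrefl      : ∀ x → ¬ (x # x)
    #-sym         : ∀ {x y} → x # y → y # x
    #-cotrans     : ∀ {x z} → x # z → ∀ y → (x # y) ⊎ (y # z)
    #-ext         : ∀ {x x′ y y′} → x ≈ x′ → y ≈ y′ → x # y → x′ # y′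

record SemigroupApart (c ℓ₁ ℓ₂ : Level) : Set (suc (c ⊔ ℓ₁ ⊔ ℓ₂)) where
  infixl 7 _∙_
  field
    setApart : SetApart c ℓ₁ ℓ₂
  open SetApart setApart public
  field
    _∙_    : Carrier → Carrier → Carrier
    ∙-cong : ∀ {a a′ x x′} → a ≈ a′ → x ≈ x′ → a ∙ x ≈ a′ ∙ x′
    assoc  : ∀ a b c → (a ∙ b) ∙ c ≈ a ∙ (b ∙ c)
    ∙-se   : ∀ {a b x y} → (a ∙ x) # (b ∙ y) → (a # b) ⊎ (x # y)

module _ {c ℓ₁ ℓ₂ : Level} (X : SetApart c ℓ₁ ℓ₂) where
  open SetApart X

  record SEMap : Set (c ⊔ ℓ₁ ⊔ ℓ₂) where
    field
      fun  : Carrier → Carrier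
      cong : ∀ {x y} → x ≈ y → fun x ≈ fun y
      se   : ∀ {x y} → fun x # fun y → x # y
  open SEMap public

  _≈ᵀ_ : SEMap → SEMap → Set (c ⊔ ℓ₁)
  f ≈ᵀ g = ∀ x → fun f x ≈ fun g x

  _#ᵀ_ : SEMap → SEMap → Set (c ⊔ ℓ₂)
  f #ᵀ g = ∃ λ x → fun f x # fun g x

  _∘ᵀ_ : SEMap → SEMap → SEMap
  f ∘ᵀ g = record
    { fun  = λ x → fun f (fun g x)
    ; cong = λ e → cong f (cong g e)
    ; se   = λ a → se g (se f a)
    }

record SEEmbedding {c ℓ₁ ℓ₂ c′ ℓ₁′ ℓ₂′ : Level}
       (S : SemigroupApart c ℓ₁ ℓ₂) (X : SetApart c′ ℓ₁′ ℓ₂′)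
       : Set (c ⊔ ℓ₁ ⊔ ℓ₂ ⊔ c′ ⊔ ℓ₁′ ⊔ ℓ₂′) where
  private module S = SemigroupApart S
  field
    φ         : S.Carrier → SEMap X
    φ-cong    : ∀ {a b} → a S.≈ b → _≈ᵀ_ X (φ a) (φ b)
    homo      : ∀ a b → _≈ᵀ_ X (φ (a S.∙ b)) (_∘ᵀ_ X (φ a) (φ b))
    injective : ∀ {a b} → _≈ᵀ_ X (φ a) (φ b) → a S.≈ b
    φ-se      : ∀ {a b} → _#ᵀ_ X (φ a) (φ b) → a S.# b

{-# OPTIONS --safe #-}
module Submission where

open import Defs
open import Level using (Level)
open import Data.Product using (Σ; _,_)
open import Data.Maybe using (Maybe; nothing; just)
open import Data.Sum using (_⊎_; inj₁; inj₂)
open import Data.Empty using (⊥-elim)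
open import Data.Empty.Polymorphic using (⊥)
open import Data.Unit.Polymorphic using (⊤; tt)
open import Relation.Nullary using (¬_)
open import Relation.Binary.Structures using (IsEquivalence)

-- Cayley's regular representation: let S act by left multiplication on S¹,
-- S with an identity adjoined. Left multiplication by a sends the new point
-- to a, which makes the representation injective and strongly extensional;
-- strong extensionality of each translation is the cancellation property
-- a x # a y ⇒ x # y, a consequence of ∙-se and irreflexivity.

module AdjoinPoint {c ℓ₁ ℓ₂ : Level} (A : SetApart c ℓ₁ ℓ₂) where
  open SetApart A
  private module ≈ = IsEquivalence isEquivalence

  infix 4 _≈⁺_ _#⁺_

  _≈⁺_ : Maybe Carrier → Maybe Carrier → Set ℓ₁
  nothing ≈⁺ nothing = ⊤
  nothing ≈⁺ just _  = ⊥
  just _  ≈⁺ nothing = ⊥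
  just x  ≈⁺ just y  = x ≈ y

  _#⁺_ : Maybe Carrier → Maybe Carrier → Set ℓ₂
  nothing #⁺ nothing = ⊥
  nothing #⁺ just _  = ⊤
  just _  #⁺ nothing = ⊤
  just x  #⁺ just y  = x # y

  ≈⁺-refl : ∀ {x} → x ≈⁺ x
  ≈⁺-refl {nothing} = tt
  ≈⁺-refl {just _}  = ≈.refl

  ≈⁺-sym : ∀ {x y} → x ≈⁺ y → y ≈⁺ x
  ≈⁺-sym {nothing} {nothing} _ = tt
  ≈⁺-sym {just _}  {just _}  e = ≈.sym e

  ≈⁺-trans : ∀ {x y z} → x ≈⁺ y → y ≈⁺ z → x ≈⁺ z
  ≈⁺-trans {nothing} {nothing} {nothing} _ _ = tt
  ≈⁺-trans {just _}  {just _}  {just _}  e f = ≈.trans e f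

  #⁺-irrefl : ∀ x → ¬ (x #⁺ x)
  #⁺-irrefl nothing  ()
  #⁺-irrefl (just x) p = #-irrefl x p

  #⁺-sym : ∀ {x y} → x #⁺ y → y #⁺ x
  #⁺-sym {nothing} {just _}  _ = tt
  #⁺-sym {just _}  {nothing} _ = tt
  #⁺-sym {just _}  {just _}  p = #-sym p

  #⁺-cotrans : ∀ {x z} → x #⁺ z → ∀ y → (x #⁺ y) ⊎ (y #⁺ z)
  #⁺-cotrans {nothing} {just _}  _ nothing  = inj₂ tt
  #⁺-cotrans {nothing} {just _}  _ (just _) = inj₁ tt
  #⁺-cotrans {just _}  {nothing} _ nothing  = inj₁ tt
  #⁺-cotrans {just _}  {nothing} _ (just _) = inj₂ tt
  #⁺-cotrans {just _}  {just _}  _ nothing  = inj₁ tt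
  #⁺-cotrans {just _}  {just _}  p (just y) = #-cotrans p y

  #⁺-ext : ∀ {x x′ y y′} → x ≈⁺ x′ → y ≈⁺ y′ → x #⁺ y → x′ #⁺ y′
  #⁺-ext {nothing} {nothing} {just _}  {just _}  _ _ _ = tt
  #⁺-ext {just _}  {just _}  {nothing} {nothing} _ _ _ = tt
  #⁺-ext {just _}  {just _}  {just _}  {just _}  e f p = #-ext e f p

  setApart⁺ : SetApart c ℓ₁ ℓ₂
  setApart⁺ = record
    { Carrier       = Maybe Carrier
    ; _≈_           = _≈⁺_
    ; _#_           = _#⁺_
    ; isEquivalence = record
      { refl  = λ {x} → ≈⁺-refl {x}
      ; sym   = λ {x} {y} → ≈⁺-sym {x} {y}
      ; trans = λ {x} {y} {z} → ≈⁺-trans {x} {y} {z}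
      }
    ; inhabitant    = nothing
    ; #-irrefl      = #⁺-irrefl
    ; #-sym         = λ {x} {y} → #⁺-sym {x} {y}
    ; #-cotrans     = λ {x} {z} → #⁺-cotrans {x} {z}
    ; #-ext         = λ {x} {x′} {y} {y′} → #⁺-ext {x} {x′} {y} {y′}
    }

module ApartnessCancellation {c ℓ₁ ℓ₂ : Level} (S : SemigroupApart c ℓ₁ ℓ₂) where
  open SemigroupApart S

  #-cancelˡ : ∀ {a x y} → a ∙ x # a ∙ y → x # y
  #-cancelˡ {a} p with ∙-se p
  ... | inj₁ a#a = ⊥-elim (#-irrefl a a#a)
  ... | inj₂ x#y = x#y

  #-cancelʳ : ∀ {a b x} → a ∙ x # b ∙ x → a # b
  #-cancelʳ {x = x} p with ∙-se p
  ... | inj₁ a#b = a#b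
  ... | inj₂ x#x = ⊥-elim (#-irrefl x x#x)

module Cayley {c ℓ₁ ℓ₂ : Level} (S : SemigroupApart c ℓ₁ ℓ₂) where
  open SemigroupApart S
  open ApartnessCancellation S
  open AdjoinPoint setApart
  private module ≈ = IsEquivalence isEquivalence

  S¹ : SetApart c ℓ₁ ℓ₂
  S¹ = setApart⁺

  _·_ : Carrier → Maybe Carrier → Maybe Carrier
  a · nothing = just a
  a · just x  = just (a ∙ x)

  ·-congˡ : ∀ a {x y} → x ≈⁺ y → a · x ≈⁺ a · y
  ·-congˡ a {nothing} {nothing} _ = ≈.refl
  ·-congˡ a {just _}  {just _}  e = ∙-cong ≈.refl e

  ·-congʳ : ∀ {a b} → a ≈ b → ∀ x → a · x ≈⁺ b · x
  ·-congʳ e nothing  = e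
  ·-congʳ e (just _) = ∙-cong e ≈.refl

  ·-cancelˡ : ∀ a {x y} → a · x #⁺ a · y → x #⁺ y
  ·-cancelˡ a {nothing} {nothing} p = ⊥-elim (#-irrefl a p)
  ·-cancelˡ a {nothing} {just _}  _ = tt
  ·-cancelˡ a {just _}  {nothing} _ = tt
  ·-cancelˡ a {just _}  {just _}  p = #-cancelˡ p

  ·-cancelʳ : ∀ {a b} x → a · x #⁺ b · x → a # b
  ·-cancelʳ nothing  p = p
  ·-cancelʳ (just _) p = #-cancelʳ p

  ·-assoc : ∀ a b x → (a ∙ b) · x ≈⁺ a · (b · x)
  ·-assoc a b nothing  = ≈.refl
  ·-assoc a b (just x) = assoc a b x

  leftMul : Carrier → SEMap S¹
  leftMul a = record
    { fun  = a ·_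
    ; cong = λ {x} {y} → ·-congˡ a {x} {y}
    ; se   = λ {x} {y} → ·-cancelˡ a {x} {y}
    }

  cayleyEmbedding : SEEmbedding S S¹
  cayleyEmbedding = record
    { φ         = leftMul
    ; φ-cong    = ·-congʳ
    ; homo      = ·-assoc
    ; injective = λ φa≈φb → φa≈φb nothing
    ; φ-se      = λ { (x , p) → ·-cancelʳ x p }
    }

theorem20 : {c ℓ₁ ℓ₂ : Level} (S : SemigroupApart c ℓ₁ ℓ₂) →
    Σ (SetApart c ℓ₁ ℓ₂) (λ X → SEEmbedding S X)
theorem20 S = Cayley.S¹ S , Cayley.cayleyEmbedding S
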